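{- Let $k\ge2$, let $G=(V,E)$ be a graph, and let $L$ be a sequence of moves that is improving from an initial configuration $\tau_0\in[k]^V$ with respect to some edge weights $X\in[-1,1]^E$. Then $\mathrm{rank}(P_{L,\tau_0})\ge\frac12 c(L)$.
   Context: Let $\sigma(1),\dots,\sigma(k)\in\mathbb{R}^{k-1}$ be unit vectors with $\langle\sigma(i),\sigma(j)\rangle=-\frac1{k-1}$ for $i\ne j$ (centered vertices of a regular simplex). A configuration is $\tau\in[k]^V$ and $H(\tau):=-\frac{k-1}{k}\sum_{uv\in E}X_{uv}\langle\sigma(\tau(u)),\sigma(\tau(v))\rangle$. A move is $(v,p,q)$ with $p\ne q\in[k]$, valid for $\tau$ if $\tau(v)=p$. A sequence $L$ has moves $L(t)=(v_t,p_t,q_t)$; it is valid from $\tau_0$ if each $L(t)$ is valid for $\tau_{t-1}$, where $\tau_t$ is $\tau_{t-1}$ with $v_t$ moved to part $q_t$; it is improving from $\tau_0$ w.r.t. $X$ if valid and $H(\tau_t)-H(\tau_{t-1})>0$ for all $t$. $M_{L,\tau_0}\in\{0,\pm1\}^{E\times[\ell(L)]}$: $M[\{a,b\},t]=+1$ if ($a=v_t$, $q_t=\tau_t(b)$) or ($b=v_t$, $q_t=\tau_t(a)$); $-1$ if ($a=v_t$, $p_t=\tau_t(b)$) or ($b=v_t$, $p_t=\tau_t(a)$); $0$ otherwise. A $w$-circuit over $v$ is a set of time steps $t_1<\dots<t_w$ with $v_{t_i}=v$, $q_{t_i}=p_{t_{i+1}}$ ($i<w$), $q_{t_w}=p_{t_1}$;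 a cycle is an inclusion-wise minimal circuit, $T(C)$ its time steps, $\Gamma(L)$ the set of cycles. $P_{L,\tau_0}\in\mathbb{Z}^{E\times\Gamma(L)}$, $P_{L,\tau_0}[\{a,b\},C]:=\sum_{t\in T(C)}M_{L,\tau_0}[\{a,b\},t]$. A vertex is cyclic in $L$ if some cycle of $L$ is over it; $c(L)$ is the number of cyclic vertices.
   Formalization: The edge weights $X$ are rational. -}

module Defs where

open import Data.Nat as ℕ using (ℕ; zero; suc)
open import Data.Fin as Fin using (Fin; toℕ)
open import Data.Bool using (Bool; true; false; if_then_else_; _∧_; _∨_)
open import Data.Product using (Σ; ∃; _×_; _,_; proj₁; proj₂)
open import Data.Sum using (_⊎_)
open import Data.Empty using (⊥)
open import Data.List using (List; []; _∷_; length; lookup; take)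
open import Data.List.Relation.Unary.All using (All)
open import Data.List.Relation.Unary.Linked using (Linked)
open import Data.List.Membership.Propositional using (_∈_)
open import Data.Integer as ℤ using (ℤ; +_)
open import Data.Rational as ℚ using (ℚ; 0ℚ; 1ℚ)
open import Relation.Nullary using (does; ¬_)
open import Relation.Binary.PropositionalEquality using (_≡_; _≢_)

SameEdge : ∀ {n} → Fin n × Fin n → Fin n × Fin n → Set
SameEdge (a , b) (c , d) = (a ≡ c × b ≡ d) ⊎ (a ≡ d × b ≡ c)

record Graph (n : ℕ) : Set where
  field
    m        : ℕ
    ends     : Fin m → Fin n × Fin n
    loopless : ∀ e → proj₁ (ends e) ≢ proj₂ (ends e)
    simple   : ∀ e f → SameEdge (ends e) (ends f) → e ≡ f
open Graph public

Config : ℕ → ℕ → Set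
Config n k = Fin n → Fin k

record Move (n k : ℕ) : Set where
  constructor move
  field
    vtx  : Fin n
    from : Fin k
    to   : Fin k
    p≢q  : from ≢ to
open Move public

eqF : ∀ {n} → Fin n → Fin n → Bool
eqF x y = does (x Fin.≟ y)

applyMove : ∀ {n k} → Config n k → Move n k → Config n k
applyMove τ mv u = if eqF u (vtx mv) then to mv else τ u

run : ∀ {n k} → Config n k → List (Move n k) → Config n k
run τ []       = τ
run τ (x ∷ xs) = run (applyMove τ x) xs

-- time steps t = 1..ℓ(L) are represented by t : Fin (length L) (0-based)
mv : ∀ {n k} (L : List (Move n k)) → Fin (length L) → Move n k
mv L t = lookup L t

-- τ_{t-1} and τ_t
before : ∀ {n k} → Config n k → (L : List (Move n k)) → Fin (length L) → Config n k
before τ₀ L t = run τ₀ (take (toℕ t) L)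

after : ∀ {n k} → Config n k → (L : List (Move n k)) → Fin (length L) → Config n k
after τ₀ L t = run τ₀ (take (suc (toℕ t)) L)

Valid : ∀ {n k} → Config n k → List (Move n k) → Set
Valid τ₀ L = ∀ t → before τ₀ L t (vtx (mv L t)) ≡ from (mv L t)

sumℚ : ∀ {m} → (Fin m → ℚ) → ℚ
sumℚ {zero}  f = 0ℚ
sumℚ {suc m} f = f Fin.zero ℚ.+ sumℚ (λ i → f (Fin.suc i))

sumℤ : List ℤ → ℤ
sumℤ []       = + 0
sumℤ (x ∷ xs) = x ℤ.+ sumℤ xs

-- 1/d for d ≥ 1 (only used with d ≥ 1 since k ≥ 2)
inv : ℕ → ℚ
inv zero    = 0ℚ
inv (suc d) = + 1 ℚ./ suc d

ip : (k : ℕ) → Fin k → Fin k → ℚ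
ip k i j = if eqF i j then 1ℚ else ℚ.- inv (k ℕ.∸ 1)

H : ∀ {n} (k : ℕ) (G : Graph n) → (Fin (m G) → ℚ) → Config n k → ℚ
H k G X τ = ℚ.- ((+ (k ℕ.∸ 1) ℚ./ 1) ℚ.* inv k ℚ.*
              sumℚ (λ e → X e ℚ.* ip k (τ (proj₁ (ends G e))) (τ (proj₂ (ends G e)))))

Improving : ∀ {n} (k : ℕ) (G : Graph n) → (Fin (m G) → ℚ) →
            Config n k → List (Move n k) → Set
Improving k G X τ₀ L =
  Valid τ₀ L ×
  (∀ t → 0ℚ ℚ.< H k G X (after τ₀ L t) ℚ.- H k G X (before τ₀ L t))

Mentry : ∀ {n k} (G : Graph n) → Config n k → (L : List (Move n k)) →
         Fin (m G) → Fin (length L) → ℤ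
Mentry G τ₀ L e t =
  if plus then + 1 else (if minus then ℤ.- (+ 1) else + 0)
  where
    a = proj₁ (ends G e)
    b = proj₂ (ends G e)
    v = vtx (mv L t)
    p = from (mv L t)
    q = to (mv L t)
    τt = after τ₀ L t
    plus  = (eqF a v ∧ eqF q (τt b)) ∨ (eqF b v ∧ eqF q (τt a))
    minus = (eqF a v ∧ eqF p (τt b)) ∨ (eqF b v ∧ eqF p (τt a))

lastOf : ∀ {A : Set} → A → List A → A
lastOf x []       = x
lastOf x (y ∷ ys) = lastOf y ys

WrapAround : ∀ {n k} (L : List (Move n k)) → List (Fin (length L)) → Set
WrapAround L []       = ⊥
WrapAround L (t ∷ ts) = to (mv L (lastOf t ts)) ≡ from (mv L t)

IsCircuit : ∀ {n k} (L : List (Move n k)) → Fin n → List (Fin (length L)) → Set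
IsCircuit L v ts =
  Linked Fin._<_ ts ×
  All (λ t → vtx (mv L t) ≡ v) ts ×
  Linked (λ s t → to (mv L s) ≡ from (mv L t)) ts ×
  WrapAround L ts

IsCycle : ∀ {n k} (L : List (Move n k)) → Fin n → List (Fin (length L)) → Set
IsCycle {n} L v ts =
  IsCircuit L v ts ×
  (∀ (v' : Fin n) ts' → IsCircuit L v' ts' →
     (∀ {t} → t ∈ ts' → t ∈ ts) → (∀ {t} → t ∈ ts → t ∈ ts'))

Cycle : ∀ {n k} → List (Move n k) → Set
Cycle {n} L = Σ (Fin n × List (Fin (length L))) (λ vts → IsCycle L (proj₁ vts) (proj₂ vts))

Pentry : ∀ {n k} (G : Graph n) → Config n k → (L : List (Move n k)) →
         Fin (m G) → Cycle L → ℤ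
Pentry G τ₀ L e ((v , ts) , _) = sumℤ (Data.List.map (Mentry G τ₀ L e) ts)
  where import Data.List

Cyclic : ∀ {n k} → List (Move n k) → Fin n → Set
Cyclic L v = ∃ λ ts → IsCycle L v ts

RankAtLeast : ∀ {n k} (G : Graph n) → Config n k → List (Move n k) → ℕ → Set
RankAtLeast G τ₀ L r =
  Σ (Fin r → Cycle L) λ cols →
    ∀ (c : Fin r → ℚ) →
      (∀ e → sumℚ (λ i → c i ℚ.* (Pentry G τ₀ L e (cols i) ℚ./ 1)) ≡ 0ℚ) →
      ∀ i → c i ≡ 0ℚ

-- A single move (v, p, q) changes H by a fixed constant times −Σ_e X_e M[e,t], so along an
-- improving sequence each column M[·,t] pairs with X to a nonzero number of constant sign.
-- A cycle C consists of at least one move, so P[·,C] = Σ_{t ∈ T(C)} M[·,t] also pairs with X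
-- to a nonzero number and is a nonzero column; and it is supported on the edges at the
-- vertex of C, because all moves of C move that vertex. Now pick a cyclic vertex v, a cycle C
-- over v and an edge e = vw with P[e,C] ≠ 0. No cycle over a vertex other than v and w has an
-- entry in row e, so C together with columns chosen recursively for the cyclic vertices
-- other than v and w is independent (e is a pivot row for C). Each chosen column accounts
-- for at most two cyclic vertices, hence rank P ≥ c(L)/2.
module Submission where

open import Defs
open import Data.Nat using (ℕ; _≤_; _*_)
open import Data.Fin using (Fin)
open import Data.Fin.Subset using (Subset; _∈_; ∣_∣)
open import Data.List using (List)
open import Data.Product using (∃; _×_)
open import Data.Integer using (+_; -_)
open import Data.Rational as ℚ using (ℚ)

open import Data.Bool using (Bool; false; if_then_else_; _∧_; _∨_)
open import Data.Bool.Properties using (∨-identityʳ)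
open import Data.Empty using (⊥-elim)
open import Data.Fin as F using (zero; suc)
open import Data.Fin.Properties using (¬∀⟶∃¬)
open import Data.Fin.Subset using (_∉_; _⊆_; _-_; _─_; Nonempty; inside; outside)
open import Data.Fin.Subset.Properties
  using (nonempty?; p─⊥≡p; p─q⊆p; ∣p─q∣≤∣p∣; x∈p⇒∣p-x∣<∣p∣; x∉⁅y⁆⇒x≢y; Empty-unique; ∣⊥∣≡0)
open import Data.Integer as ℤ using (ℤ)
import Data.Integer.Properties as ℤP
open import Data.List using ([]; _∷_; map)
open import Data.List.Relation.Unary.All as All using (All; []; _∷_)
import Data.Nat as ℕ
import Data.Nat.Coprimality as Coprime
import Data.Nat.Properties as ℕP
open import Data.Product using (Σ; _,_; proj₁; proj₂)
open import Data.Rational using (0ℚ; 1ℚ)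
import Data.Rational.Properties as ℚP
open import Data.Rational.Solver using (module +-*-Solver)
open +-*-Solver using (solve; _:=_; _:+_; _:*_; :-_; con)
open import Data.Sum using (_⊎_; inj₁; inj₂; [_,_])
open import Data.Vec using (_∷_; there)
import Data.Vec.Functional as Vector
open import Function using (_∘_)
open import Relation.Nullary using (¬_; Dec; yes; no)
open import Relation.Nullary.Decidable using (dec-false; _⊎-dec_)
open import Relation.Binary.PropositionalEquality
  using (_≡_; _≢_; refl; sym; trans; cong; cong₂; subst; module ≡-Reasoning)

open import Algebra.Bundles using (CommutativeRing)
open import Algebra.Properties.Semiring.Sum (CommutativeRing.semiring ℚP.+-*-commutativeRing)
  using (sum; sum-cong-≗; ∑-distrib-+; *-distribʳ-sum; sum-replicate-zero)

sumℚ≡sum : ∀ {d} (f : Fin d → ℚ) → sumℚ f ≡ sum f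
sumℚ≡sum {ℕ.zero}  f = refl
sumℚ≡sum {ℕ.suc d} f = cong (f zero ℚ.+_) (sumℚ≡sum (f ∘ suc))

sumℚ-cong : ∀ {d} {f g : Fin d → ℚ} → (∀ i → f i ≡ g i) → sumℚ f ≡ sumℚ g
sumℚ-cong {f = f} {g} f≗g = trans (sumℚ≡sum f) (trans (sum-cong-≗ f≗g) (sym (sumℚ≡sum g)))

sumℚ-zero : ∀ {d} {f : Fin d → ℚ} → (∀ i → f i ≡ 0ℚ) → sumℚ f ≡ 0ℚ
sumℚ-zero {d} f≗0 =
  trans (sumℚ-cong f≗0) (trans (sumℚ≡sum {d} (λ _ → 0ℚ)) (sum-replicate-zero d))

sumℚ-distrib-+ : ∀ {d} (f g : Fin d → ℚ) → sumℚ (λ i → f i ℚ.+ g i) ≡ sumℚ f ℚ.+ sumℚ g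
sumℚ-distrib-+ f g = trans (sumℚ≡sum (λ i → f i ℚ.+ g i))
  (trans (∑-distrib-+ f g) (sym (cong₂ ℚ._+_ (sumℚ≡sum f) (sumℚ≡sum g))))

sumℚ-distribʳ-* : ∀ {d} (f : Fin d → ℚ) x → sumℚ (λ i → f i ℚ.* x) ≡ sumℚ f ℚ.* x
sumℚ-distribʳ-* f x = trans (sumℚ≡sum (λ i → f i ℚ.* x))
  (sym (trans (cong (ℚ._* x) (sumℚ≡sum f)) (*-distribʳ-sum x f)))

/1-homo-+ : ∀ i j → (i ℤ.+ j) ℚ./ 1 ≡ i ℚ./ 1 ℚ.+ j ℚ./ 1
/1-homo-+ i j = begin
  (i ℤ.+ j) ℚ./ 1                  ≡⟨ cong₂ (λ x y → (x ℤ.+ y) ℚ./ 1) (ℤP.*-identityʳ i) (ℤP.*-identityʳ j) ⟨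
  (i ℤ.* + 1 ℤ.+ j ℤ.* + 1) ℚ./ 1  ≡⟨⟩
  integer i ℚ.+ integer j          ≡⟨ cong₂ ℚ._+_ (ℚP.↥p/↧p≡p (integer i)) (ℚP.↥p/↧p≡p (integer j)) ⟨
  i ℚ./ 1 ℚ.+ j ℚ./ 1              ∎
  where
  open ≡-Reasoning
  integer : ℤ → ℚ
  integer z = ℚ.mkℚ z 0 (Coprime.sym (Coprime.1-coprimeTo ℤ.∣ z ∣))

p*q≡0⇒p≡0 : ∀ p q → q ≢ 0ℚ → p ℚ.* q ≡ 0ℚ → p ≡ 0ℚ
p*q≡0⇒p≡0 p q q≢0 pq≡0 = begin
  p                     ≡⟨ ℚP.*-identityʳ p ⟨
  p ℚ.* 1ℚ              ≡⟨ cong (p ℚ.*_) (ℚP.*-inverseʳ q) ⟨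
  p ℚ.* (q ℚ.* ℚ.1/ q)  ≡⟨ ℚP.*-assoc p q _ ⟨
  p ℚ.* q ℚ.* ℚ.1/ q    ≡⟨ cong (ℚ._* ℚ.1/ q) pq≡0 ⟩
  0ℚ ℚ.* ℚ.1/ q         ≡⟨ ℚP.*-zeroˡ (ℚ.1/ q) ⟩
  0ℚ                    ∎
  where
  open ≡-Reasoning
  instance _ = ℚ.≢-nonZero q≢0

ColumnsIndependent : ∀ {d r} → (Fin d → Fin r → ℚ) → Set
ColumnsIndependent {r = r} A =
  ∀ (c : Fin r → ℚ) → (∀ e → sumℚ (λ i → c i ℚ.* A e i) ≡ 0ℚ) → ∀ i → c i ≡ 0ℚ

independent-by-pivot : ∀ {d r} (A : Fin d → Fin (ℕ.suc r) → ℚ) e₀ →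
  A e₀ zero ≢ 0ℚ → (∀ i → A e₀ (suc i) ≡ 0ℚ) →
  ColumnsIndependent (λ e i → A e (suc i)) → ColumnsIndependent A
independent-by-pivot A e₀ pivot≢0 off-pivot≡0 independent c Ac≡0 = c≡0
  where
  open ≡-Reasoning
  rest : Fin _ → ℚ
  rest e = sumℚ (λ i → c (suc i) ℚ.* A e (suc i))

  c₀≡0 : c zero ≡ 0ℚ
  c₀≡0 = p*q≡0⇒p≡0 (c zero) (A e₀ zero) pivot≢0 (begin
    c zero ℚ.* A e₀ zero              ≡⟨ ℚP.+-identityʳ _ ⟨
    c zero ℚ.* A e₀ zero ℚ.+ 0ℚ       ≡⟨ cong (c zero ℚ.* A e₀ zero ℚ.+_) rest₀≡0 ⟨
    c zero ℚ.* A e₀ zero ℚ.+ rest e₀  ≡⟨ Ac≡0 e₀ ⟩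
    0ℚ                                ∎)
    where
    rest₀≡0 : rest e₀ ≡ 0ℚ
    rest₀≡0 = sumℚ-zero λ i →
      trans (cong (c (suc i) ℚ.*_) (off-pivot≡0 i)) (ℚP.*-zeroʳ (c (suc i)))

  rest≡0 : ∀ e → rest e ≡ 0ℚ
  rest≡0 e = begin
    rest e                          ≡⟨ ℚP.+-identityˡ (rest e) ⟨
    0ℚ ℚ.+ rest e                   ≡⟨ cong (ℚ._+ rest e) (ℚP.*-zeroˡ (A e zero)) ⟨
    0ℚ ℚ.* A e zero ℚ.+ rest e      ≡⟨ cong (λ x → x ℚ.* A e zero ℚ.+ rest e) c₀≡0 ⟨
    c zero ℚ.* A e zero ℚ.+ rest e  ≡⟨ Ac≡0 e ⟩
    0ℚ                              ∎

  c≡0 : ∀ i → c i ≡ 0ℚ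
  c≡0 zero    = c₀≡0
  c≡0 (suc i) = independent (c ∘ suc) rest≡0 i

∣p∣≤1+∣p-x∣ : ∀ {n} (p : Subset n) x → ∣ p ∣ ≤ ℕ.suc ∣ p - x ∣
∣p∣≤1+∣p-x∣ (inside  ∷ p) zero    = ℕP.≤-reflexive (cong (ℕ.suc ∘ ∣_∣) (sym (p─⊥≡p p)))
∣p∣≤1+∣p-x∣ (outside ∷ p) zero    = ℕP.m≤n⇒m≤1+n (ℕP.≤-reflexive (cong ∣_∣ (sym (p─⊥≡p p))))
∣p∣≤1+∣p-x∣ (inside  ∷ p) (suc x) = ℕ.s≤s (∣p∣≤1+∣p-x∣ p x)
∣p∣≤1+∣p-x∣ (outside ∷ p) (suc x) = ∣p∣≤1+∣p-x∣ p x

x∈p─q⇒x∉q : ∀ {n} {p q : Subset n} {x} → x ∈ p ─ q → x ∉ q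
x∈p─q⇒x∉q {p = _ ∷ p} {_ ∷ q} (there x∈p─q) (there x∈q) = x∈p─q⇒x∉q {p = p} {q} x∈p─q x∈q

x∈p-y⇒x≢y : ∀ {n} {p : Subset n} {x y} → x ∈ p - y → x ≢ y
x∈p-y⇒x≢y {p = p} x∈p-y = x∉⁅y⁆⇒x≢y (x∈p─q⇒x∉q {p = p} x∈p-y)

p-x-y⊆p : ∀ {n} (p : Subset n) x y → p - x - y ⊆ p
p-x-y⊆p p x y = p─q⊆p p _ ∘ p─q⊆p (p - x) _

Incident : ∀ {n} (G : Graph n) → Fin (m G) → Fin n → Set
Incident G e v = proj₁ (ends G e) ≡ v ⊎ proj₂ (ends G e) ≡ v

incident? : ∀ {n} (G : Graph n) e v → Dec (Incident G e v)
incident? G e v = (proj₁ (ends G e) F.≟ v) ⊎-dec (proj₂ (ends G e) F.≟ v)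

other-endpoint : ∀ {n} (G : Graph n) {e v} → Incident G e v →
  ∃ λ w → ∀ {u} → Incident G e u → u ≡ v ⊎ u ≡ w
other-endpoint G {e} (inj₁ refl) =
  proj₂ (ends G e) , λ { (inj₁ refl) → inj₁ refl ; (inj₂ refl) → inj₂ refl }
other-endpoint G {e} (inj₂ refl) =
  proj₁ (ends G e) , λ { (inj₁ refl) → inj₂ refl ; (inj₂ refl) → inj₁ refl }

module IncidenceColumns {n} (G : Graph n) {Col : Set} (vertex : Col → Fin n)
  (A : Fin (m G) → Col → ℚ)
  (supported : ∀ e C → ¬ Incident G e (vertex C) → A e C ≡ 0ℚ)
  (nonzero : ∀ C → ∃ λ e → A e C ≢ 0ℚ) where

  record Pivot (C : Col) : Set where
    field
      edge       : Fin (m G)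
      partner    : Fin n
      nonzero-at : A edge C ≢ 0ℚ
      endpoints  : ∀ {u} → Incident G edge u → u ≡ vertex C ⊎ u ≡ partner

  pivot : ∀ C → Pivot C
  pivot C with nonzero C
  ... | e , A≢0 with incident? G e (vertex C)
  ...   | yes incident = record
    { edge = e ; partner = proj₁ (other-endpoint G incident)
    ; nonzero-at = A≢0 ; endpoints = proj₂ (other-endpoint G incident) }
  ...   | no ¬incident = ⊥-elim (A≢0 (supported e C ¬incident))

  record IndependentCover (S : Subset n) : Set where
    field
      size        : ℕ
      columns     : Fin size → Col
      independent : ColumnsIndependent (λ e i → A e (columns i))
      covers      : ∣ S ∣ ≤ 2 * size
      within      : ∀ i → vertex (columns i) ∈ S

  Covered : Subset n → Set
  Covered S = ∀ v → v ∈ S → Σ Col λ C → vertex C ≡ v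

  empty-cover : ∀ {S} → ¬ Nonempty S → IndependentCover S
  empty-cover S-empty = record
    { size = 0 ; columns = λ () ; independent = λ _ _ () ; within = λ ()
    ; covers = ℕP.≤-reflexive (trans (cong ∣_∣ (Empty-unique S-empty)) (∣⊥∣≡0 n)) }

  extend : ∀ {S} C (P : Pivot C) → vertex C ∈ S →
    IndependentCover (S - vertex C - Pivot.partner P) → IndependentCover S
  extend {S} C P vC∈S cover = record
    { size        = ℕ.suc size
    ; columns     = C Vector.∷ columns
    ; independent = independent-by-pivot (λ e i → A e ((C Vector.∷ columns) i))
                      edge nonzero-at off-pivot independent
    ; covers      = covers′
    ; within      = λ { zero → vC∈S ; (suc i) → p-x-y⊆p S (vertex C) partner (within i) }
    }
    where
    open Pivot P
    open IndependentCover cover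
    off-pivot : ∀ i → A edge (columns i) ≡ 0ℚ
    off-pivot i = supported edge (columns i) λ incident →
      [ x∈p-y⇒x≢y (p─q⊆p (S - vertex C) _ (within i)) , x∈p-y⇒x≢y (within i) ]
        (endpoints incident)
    covers′ : ∣ S ∣ ≤ 2 * ℕ.suc size
    covers′ = begin
      ∣ S ∣                                     ≤⟨ ∣p∣≤1+∣p-x∣ S (vertex C) ⟩
      ℕ.suc ∣ S - vertex C ∣                    ≤⟨ ℕ.s≤s (∣p∣≤1+∣p-x∣ (S - vertex C) partner) ⟩
      ℕ.suc (ℕ.suc ∣ S - vertex C - partner ∣)  ≤⟨ ℕ.s≤s (ℕ.s≤s covers) ⟩
      ℕ.suc (ℕ.suc (2 * size))                  ≡⟨ ℕP.*-suc 2 size ⟨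
      2 * ℕ.suc size                            ∎
      where open ℕP.≤-Reasoning

  cover : ∀ N S → ∣ S ∣ ≤ N → Covered S → IndependentCover S
  cover N S _ covered with nonempty? S
  ... | no S-empty = empty-cover S-empty
  cover ℕ.zero S ∣S∣≤0 covered | yes (v , v∈S) =
    ⊥-elim (ℕP.n≮0 (ℕP.<-≤-trans (x∈p⇒∣p-x∣<∣p∣ v∈S) ∣S∣≤0))
  cover (ℕ.suc N) S ∣S∣≤1+N covered | yes (v , v∈S) =
    extend C (pivot C) vC∈S (cover N S′ ∣S′∣≤N λ u u∈S′ → covered u (p-x-y⊆p S _ _ u∈S′))
    where
    C = proj₁ (covered v v∈S)
    vC∈S : vertex C ∈ S
    vC∈S = subst (_∈ S) (sym (proj₂ (covered v v∈S))) v∈S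
    S′ = S - vertex C - Pivot.partner (pivot C)
    ∣S′∣≤N : ∣ S′ ∣ ≤ N
    ∣S′∣≤N = ℕP.≤-pred (ℕP.≤-trans (ℕ.s≤s (∣p─q∣≤∣p∣ (S - vertex C) _))
                                     (ℕP.≤-trans (x∈p⇒∣p-x∣<∣p∣ vC∈S) ∣S∣≤1+N))

  many-independent-columns : ∀ S → Covered S →
    ∃ λ r → (Σ (Fin r → Col) λ cols → ColumnsIndependent (λ e i → A e (cols i))) × ∣ S ∣ ≤ 2 * r
  many-independent-columns S covered = size , (columns , independent) , covers
    where open IndependentCover (cover ∣ S ∣ S ℕP.≤-refl covered)

eqF-≢ : ∀ {n} {x y : Fin n} → x ≢ y → eqF x y ≡ false
eqF-≢ {x = x} {y} x≢y = dec-false (x F.≟ y) x≢y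

after≡applyMove-before : ∀ {n k} (τ₀ : Config n k) L t →
  after τ₀ L t ≡ applyMove (before τ₀ L t) (mv L t)
after≡applyMove-before τ₀ (mo ∷ L) zero    = refl
after≡applyMove-before τ₀ (mo ∷ L) (suc t) = after≡applyMove-before (applyMove τ₀ mo) L t

ip-≢ : ∀ k {i j : Fin k} → i ≢ j → ip k i j ≡ ℚ.- inv (k ℕ.∸ 1)
ip-≢ k i≢j = cong (λ b → if b then 1ℚ else ℚ.- inv (k ℕ.∸ 1)) (eqF-≢ i≢j)

ip-sym : ∀ k (i j : Fin k) → ip k i j ≡ ip k j i
ip-sym k i j = by-cases (i F.≟ j)
  where
  by-cases : Dec (i ≡ j) → ip k i j ≡ ip k j i
  by-cases (yes i≡j) = cong₂ (ip k) i≡j (sym i≡j)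
  by-cases (no i≢j)  = trans (ip-≢ k i≢j) (sym (ip-≢ k (i≢j ∘ sym)))

ip-gap : ℕ → ℚ
ip-gap k = 1ℚ ℚ.+ inv (k ℕ.∸ 1)

signed : Bool → Bool → ℤ
signed plus minus = if plus then + 1 else (if minus then - (+ 1) else + 0)

ip-move : ∀ k {p q : Fin k} → p ≢ q → ∀ x →
  ip k q x ≡ ip k p x ℚ.+ (signed (eqF q x) (eqF p x) ℚ./ 1) ℚ.* ip-gap k
ip-move k {p} {q} p≢q x with q F.≟ x | p F.≟ x
... | yes refl | yes refl = ⊥-elim (p≢q refl)
... | yes refl | no _     =
  solve 1 (λ I → con 1ℚ := :- I :+ con 1ℚ :* (con 1ℚ :+ I)) refl (inv (k ℕ.∸ 1))
... | no _     | yes refl =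
  solve 1 (λ I → :- I := con 1ℚ :+ con (ℚ.- 1ℚ) :* (con 1ℚ :+ I)) refl (inv (k ℕ.∸ 1))
... | no _     | no _     =
  solve 1 (λ I → :- I := :- I :+ con 0ℚ :* (con 1ℚ :+ I)) refl (inv (k ℕ.∸ 1))

-- Mentry G τ₀ L e t unfolds to move-entry (mv L t) (after τ₀ L t) applied to the ends of e.
move-entry : ∀ {n k} → Move n k → Config n k → Fin n → Fin n → ℤ
move-entry mo τ a b = signed
  ((eqF a (vtx mo) ∧ eqF (to mo) (τ b)) ∨ (eqF b (vtx mo) ∧ eqF (to mo) (τ a)))
  ((eqF a (vtx mo) ∧ eqF (from mo) (τ b)) ∨ (eqF b (vtx mo) ∧ eqF (from mo) (τ a)))

move-entry-nonincident : ∀ {n k} (mo : Move n k) τ {a b} →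
  a ≢ vtx mo → b ≢ vtx mo → move-entry mo τ a b ≡ + 0
move-entry-nonincident mo τ a≢v b≢v rewrite eqF-≢ a≢v | eqF-≢ b≢v = refl

ip-applyMove : ∀ {n k} (τ : Config n k) mo → τ (vtx mo) ≡ from mo → ∀ {a b} → a ≢ b →
  ip k (applyMove τ mo a) (applyMove τ mo b)
    ≡ ip k (τ a) (τ b) ℚ.+ (move-entry mo (applyMove τ mo) a b ℚ./ 1) ℚ.* ip-gap k
ip-applyMove {k = k} τ mo τv≡p {a} {b} a≢b with a F.≟ vtx mo | b F.≟ vtx mo
... | yes refl | yes b≡v = ⊥-elim (a≢b (sym b≡v))
... | yes refl | no _
  rewrite τv≡p | ∨-identityʳ (eqF (to mo) (τ b)) | ∨-identityʳ (eqF (from mo) (τ b))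
  = ip-move k (p≢q mo) (τ b)
... | no _ | yes refl
  rewrite τv≡p | ip-sym k (τ a) (to mo) | ip-sym k (τ a) (from mo)
  = ip-move k (p≢q mo) (τ a)
... | no _ | no _
  = sym (trans (cong (ip k (τ a) (τ b) ℚ.+_) (ℚP.*-zeroˡ (ip-gap k))) (ℚP.+-identityʳ _))

dot : ∀ {d} → (Fin d → ℚ) → (Fin d → ℤ) → ℚ
dot X col = sumℚ (λ e → X e ℚ.* (col e ℚ./ 1))

dot-+ : ∀ {d} (X : Fin d → ℚ) f g → dot X (λ e → f e ℤ.+ g e) ≡ dot X f ℚ.+ dot X g
dot-+ X f g = trans (sumℚ-cong split)
  (sumℚ-distrib-+ (λ e → X e ℚ.* (f e ℚ./ 1)) (λ e → X e ℚ.* (g e ℚ./ 1)))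
  where
  split : ∀ e → X e ℚ.* ((f e ℤ.+ g e) ℚ./ 1) ≡ X e ℚ.* (f e ℚ./ 1) ℚ.+ X e ℚ.* (g e ℚ./ 1)
  split e = trans (cong (X e ℚ.*_) (/1-homo-+ (f e) (g e))) (ℚP.*-distribˡ-+ (X e) _ _)

dot-zero : ∀ {d} (X : Fin d → ℚ) {f} → (∀ e → f e ℚ./ 1 ≡ 0ℚ) → dot X f ≡ 0ℚ
dot-zero X f≡0 = sumℚ-zero λ e → trans (cong (X e ℚ.*_) (f≡0 e)) (ℚP.*-zeroʳ (X e))

module _ {d l} (X : Fin d → ℚ) (c : ℚ) (M : Fin d → Fin l → ℤ)
         (positive : ∀ t → 0ℚ ℚ.< c ℚ.* dot X (λ e → M e t)) where

  dot-sumℤ-nonneg : ∀ ts → 0ℚ ℚ.≤ c ℚ.* dot X (λ e → sumℤ (map (M e) ts))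
  dot-sumℤ-pos : ∀ t ts → 0ℚ ℚ.< c ℚ.* dot X (λ e → sumℤ (map (M e) (t ∷ ts)))

  dot-sumℤ-nonneg []       =
    ℚP.≤-reflexive (sym (trans (cong (c ℚ.*_) (dot-zero X {λ _ → + 0} λ _ → refl)) (ℚP.*-zeroʳ c)))
  dot-sumℤ-nonneg (t ∷ ts) = ℚP.<⇒≤ (dot-sumℤ-pos t ts)

  dot-sumℤ-pos t ts =
    subst (0ℚ ℚ.<_) (sym split) (ℚP.+-mono-<-≤ (positive t) (dot-sumℤ-nonneg ts))
    where
    split : c ℚ.* dot X (λ e → sumℤ (map (M e) (t ∷ ts)))
          ≡ c ℚ.* dot X (λ e → M e t) ℚ.+ c ℚ.* dot X (λ e → sumℤ (map (M e) ts))
    split = trans (cong (c ℚ.*_) (dot-+ X (λ e → M e t) (λ e → sumℤ (map (M e) ts))))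
                  (ℚP.*-distribˡ-+ c _ _)

energy-scale : ℕ → ℚ
energy-scale k = (+ (k ℕ.∸ 1) ℚ./ 1) ℚ.* inv k

-- Equal to −1 whenever k ≥ 2; the argument only needs it to be a constant.
gain-coefficient : ℕ → ℚ
gain-coefficient k = ℚ.- (energy-scale k ℚ.* ip-gap k)

H-applyMove : ∀ {n} k (G : Graph n) X (τ τ′ : Config n k) mo →
  τ (vtx mo) ≡ from mo → τ′ ≡ applyMove τ mo →
  H k G X τ′ ℚ.- H k G X τ
    ≡ gain-coefficient k ℚ.* dot X (λ e → move-entry mo τ′ (proj₁ (ends G e)) (proj₂ (ends G e)))
H-applyMove k G X τ τ′ mo τv≡p refl = begin
  ℚ.- (s ℚ.* S τ′) ℚ.- ℚ.- (s ℚ.* S τ)               ≡⟨ cong (λ x → ℚ.- (s ℚ.* x) ℚ.- ℚ.- (s ℚ.* S τ)) S-step ⟩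
  ℚ.- (s ℚ.* (S τ ℚ.+ W ℚ.* g)) ℚ.- ℚ.- (s ℚ.* S τ)  ≡⟨ solve 4 (λ s g Sτ W → :- (s :* (Sτ :+ W :* g)) :+ :- (:- (s :* Sτ))
                                                               := :- (s :* g) :* W) refl s g (S τ) W ⟩
  gain-coefficient k ℚ.* W                            ∎
  where
  open ≡-Reasoning
  s = energy-scale k
  g = ip-gap k
  a b : Fin (m G) → Fin _
  a e = proj₁ (ends G e)
  b e = proj₂ (ends G e)
  S : Config _ k → ℚ
  S σ = sumℚ (λ e → X e ℚ.* ip k (σ (a e)) (σ (b e)))
  M : Fin (m G) → ℤ
  M e = move-entry mo τ′ (a e) (b e)
  W = dot X M
  edge-step : ∀ e → X e ℚ.* ip k (τ′ (a e)) (τ′ (b e))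
                  ≡ X e ℚ.* ip k (τ (a e)) (τ (b e)) ℚ.+ X e ℚ.* (M e ℚ./ 1) ℚ.* g
  edge-step e = trans (cong (X e ℚ.*_) (ip-applyMove τ mo τv≡p (loopless G e)))
    (trans (ℚP.*-distribˡ-+ (X e) (ip k (τ (a e)) (τ (b e))) ((M e ℚ./ 1) ℚ.* g))
           (cong (X e ℚ.* ip k (τ (a e)) (τ (b e)) ℚ.+_) (sym (ℚP.*-assoc (X e) (M e ℚ./ 1) g))))
  S-step : S τ′ ≡ S τ ℚ.+ W ℚ.* g
  S-step = trans (sumℚ-cong edge-step)
    (trans (sumℚ-distrib-+ _ (λ e → X e ℚ.* (M e ℚ./ 1) ℚ.* g))
           (cong (S τ ℚ.+_) (sumℚ-distribʳ-* (λ e → X e ℚ.* (M e ℚ./ 1)) g)))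

sumℤ-map-zero : ∀ {A : Set} {f : A → ℤ} {xs} → All (λ x → f x ≡ + 0) xs → sumℤ (map f xs) ≡ + 0
sumℤ-map-zero []             = refl
sumℤ-map-zero (fx≡0 ∷ fxs≡0) = cong₂ ℤ._+_ fx≡0 (sumℤ-map-zero fxs≡0)

vertex : ∀ {n k} {L : List (Move n k)} → Cycle L → Fin n
vertex ((v , _) , _) = v

module _ {n k} (G : Graph n) (X : Fin (m G) → ℚ) (τ₀ : Config n k) (L : List (Move n k)) where

  Pentry-nonincident : ∀ e (C : Cycle L) → ¬ Incident G e (vertex C) →
    Pentry G τ₀ L e C ℚ./ 1 ≡ 0ℚ
  Pentry-nonincident e ((v , ts) , (_ , moves-v , _) , _) ¬incident =
    cong (ℚ._/ 1) (sumℤ-map-zero (All.map entry≡0 moves-v))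
    where
    entry≡0 : ∀ {t} → vtx (mv L t) ≡ v → Mentry G τ₀ L e t ≡ + 0
    entry≡0 vt≡v = move-entry-nonincident (mv L _) (after τ₀ L _)
      (λ a≡vt → ¬incident (inj₁ (trans a≡vt vt≡v)))
      (λ b≡vt → ¬incident (inj₂ (trans b≡vt vt≡v)))

  Pentry-nonzero : Improving k G X τ₀ L → ∀ (C : Cycle L) →
    ∃ λ e → Pentry G τ₀ L e C ℚ./ 1 ≢ 0ℚ
  Pentry-nonzero _ ((_ , []) , (_ , _ , _ , ()) , _)
  Pentry-nonzero (valid , improves) ((_ , t ∷ ts) , _) =
    ¬∀⟶∃¬ (m G) _ (λ e → _ ℚP.≟ 0ℚ) λ column≡0 →
      ℚP.<-irrefl (sym (gain≡0 column≡0)) (dot-sumℤ-pos X κ (Mentry G τ₀ L) move-gain t ts)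
    where
    κ = gain-coefficient k
    column : Fin (m G) → ℤ
    column e = sumℤ (map (Mentry G τ₀ L e) (t ∷ ts))
    gain≡0 : (∀ e → column e ℚ./ 1 ≡ 0ℚ) → κ ℚ.* dot X column ≡ 0ℚ
    gain≡0 column≡0 = trans (cong (κ ℚ.*_) (dot-zero X {column} column≡0)) (ℚP.*-zeroʳ κ)
    move-gain : ∀ t → 0ℚ ℚ.< κ ℚ.* dot X (λ e → Mentry G τ₀ L e t)
    move-gain t = subst (0ℚ ℚ.<_)
      (H-applyMove k G X (before τ₀ L t) (after τ₀ L t) (mv L t) (valid t)
                   (after≡applyMove-before τ₀ L t))
      (improves t)

lemma4p13 : ∀ {n} (k : ℕ) → 2 ≤ k → (G : Graph n) (X : Fin (m G) → ℚ) →
    (∀ e → ((- (+ 1)) ℚ./ 1) ℚ.≤ X e × X e ℚ.≤ ((+ 1) ℚ./ 1)) →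
    (τ₀ : Config n k) (L : List (Move n k)) → Improving k G X τ₀ L →
    (S : Subset n) → (∀ v → v ∈ S → Cyclic L v) →
    ∃ λ r → RankAtLeast G τ₀ L r × ∣ S ∣ ≤ 2 * r
lemma4p13 k _ G X _ τ₀ L improving S cyclic =
  many-independent-columns S λ v v∈S → ((v , proj₁ (cyclic v v∈S)) , proj₂ (cyclic v v∈S)) , refl
  where
  open IncidenceColumns G vertex (λ e C → Pentry G τ₀ L e C ℚ./ 1)
         (Pentry-nonincident G X τ₀ L) (Pentry-nonzero G X τ₀ L improving)
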